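{- Let $d$ be a positive integer, let $G=(V,E)$ be a $d$-sparse graph, and let $H_1=(U_1,F_1)$ and $H_2=(U_2,F_2)$ be distinct $d$-critical components of $G$. Then $|U_1\cap U_2|\le d-1$, and if $|U_1\cap U_2|=d-1$ then $i_G(U_1\cap U_2)=\binom{d-1}{2}$.
   Context: For $X\subseteq V$, $i_G(X)$ is the number of edges of $G$ with both ends in $X$. $G$ is $d$-sparse if $i_G(X)\le d|X|-\binom{d+1}{2}$ for all $X\subseteq V$ with $|X|\ge d$. A subgraph $(U,F)$ of a $d$-sparse graph $G$ is $d$-critical if either $|U|=2$ and $|F|=1$, or $|U|\ge d+2$ and $|F|=d|U|-\binom{d+1}{2}$. A $d$-critical component of $G$ is a $d$-critical subgraph not properly contained in any other $d$-critical subgraph of $G$. -}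

module Defs where

open import Data.Nat using (ℕ; suc; _+_; _*_; _∸_; _≤_; _≥_)
open import Data.Nat.Combinatorics using (_C_)
open import Data.Fin using (Fin)
open import Data.Fin.Subset using (Subset; ∣_∣; _⊆_; _∩_)
open import Data.Bool using (_∧_)
open import Data.Vec using (lookup; tabulate)
open import Data.Product using (_×_; _,_; proj₁; proj₂)
open import Data.Sum using (_⊎_)
open import Relation.Binary.PropositionalEquality using (_≡_; _≢_)

record Graph (n m : ℕ) : Set where
  field
    ends     : Fin m → Fin n × Fin n
    loopless : ∀ e → proj₁ (ends e) ≢ proj₂ (ends e)
    simple   : ∀ e f →
               ((ends e ≡ ends f) ⊎ (ends e ≡ (proj₂ (ends f) , proj₁ (ends f)))) →
               e ≡ f
open Graph public

module _ {n m : ℕ} (G : Graph n m) where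

  edgesIn : Subset n → Subset m
  edgesIn X = tabulate λ e → lookup X (proj₁ (ends G e)) ∧ lookup X (proj₂ (ends G e))

  i : Subset n → ℕ
  i X = ∣ edgesIn X ∣

  -- G is d-sparse: i_G(X) ≤ d|X| - C(d+1,2) for all |X| ≥ d
  -- (written additively; equivalent since d|X| ≥ d² ≥ C(d+1,2) there)
  Sparse : ℕ → Set
  Sparse d = ∀ (X : Subset n) → ∣ X ∣ ≥ d → i X + (suc d C 2) ≤ d * ∣ X ∣

  IsSubgraph : Subset n → Subset m → Set
  IsSubgraph U F = F ⊆ edgesIn U

  Critical : ℕ → Subset n → Subset m → Set
  Critical d U F =
    IsSubgraph U F ×
    ((∣ U ∣ ≡ 2 × ∣ F ∣ ≡ 1) ⊎
     (∣ U ∣ ≥ d + 2 × ∣ F ∣ ≡ d * ∣ U ∣ ∸ (suc d C 2)))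

  CriticalComponent : ℕ → Subset n → Subset m → Set
  CriticalComponent d U F =
    Critical d U F ×
    (∀ (U' : Subset n) (F' : Subset m) → Critical d U' F' →
       U ⊆ U' → F ⊆ F' → (U , F) ≡ (U' , F'))

-- Write c = C(d+1,2) and call X tight when i(X) + c = d|X|. In a d-sparse graph a d-critical
-- subgraph (U, F) has F = E(U), and it is either a single edge or U is tight. Since i is
-- supermodular, two tight sets satisfy
--   d|U₁ ∪ U₂| + d|U₁ ∩ U₂| ≤ (i(U₁ ∪ U₂) + c) + (i(U₁ ∩ U₂) + c).
-- For distinct components the union cannot be tight (it would be a critical set containing
-- both), so by sparsity it is strictly slack and the intersection must satisfy
-- i(U₁ ∩ U₂) + c > d|U₁ ∩ U₂|. This contradicts sparsity when |U₁ ∩ U₂| ≥ d, and for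
-- |U₁ ∩ U₂| = d - 1 it gives i(U₁ ∩ U₂) ≥ C(d-1,2), the number of edges of a complete graph
-- on d - 1 vertices. A single-edge component meeting the other in two vertices would lie
-- inside it, which maximality forbids.

module Submission where

open import Data.Bool using (_∧_)
open import Data.Bool.Properties using (∧-conicalˡ; ∧-conicalʳ)
open import Data.Empty using (⊥; ⊥-elim)
open import Data.Fin using (Fin; zero; suc; _≟_)
open import Data.Fin.Properties using (suc-injective)
open import Data.Fin.Subset hiding (⊥)
open import Data.Fin.Subset.Properties
open import Data.Nat using (ℕ; zero; suc; _+_; _*_; _∸_; _≤_; _<_; _≥_; z≤n; s≤s)
open import Data.Nat.Combinatorics using (_C_; nC1≡n; nCk+nC[k+1]≡[n+1]C[k+1])
open import Data.Nat.Properties as ℕ hiding (_≟_; suc-injective)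
open import Data.Nat.Tactic.RingSolver using (solve-∀)
open import Algebra.Properties.CommutativeSemigroup +-commutativeSemigroup
  using () renaming (interchange to +-interchange)
open import Data.Product using (_×_; _,_; proj₁; proj₂; swap)
open import Data.Sum using (_⊎_; inj₁; inj₂)
open import Data.Vec using (_∷_; []; here; there)
open import Data.Vec.Properties using ([]=⇒lookup; lookup⇒[]=; lookup∘tabulate)
open import Function using (id; _∘_)
open import Relation.Nullary using (¬_; yes; no)
open import Relation.Binary.PropositionalEquality

open import Defs

∣p∪q∣+∣p∩q∣≡∣p∣+∣q∣ : ∀ {n} (p q : Subset n) → ∣ p ∪ q ∣ + ∣ p ∩ q ∣ ≡ ∣ p ∣ + ∣ q ∣
∣p∪q∣+∣p∩q∣≡∣p∣+∣q∣ [] [] = refl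
∣p∪q∣+∣p∩q∣≡∣p∣+∣q∣ (outside ∷ p) (outside ∷ q) = ∣p∪q∣+∣p∩q∣≡∣p∣+∣q∣ p q
∣p∪q∣+∣p∩q∣≡∣p∣+∣q∣ (outside ∷ p) (inside ∷ q) =
  trans (cong suc (∣p∪q∣+∣p∩q∣≡∣p∣+∣q∣ p q)) (sym (+-suc ∣ p ∣ ∣ q ∣))
∣p∪q∣+∣p∩q∣≡∣p∣+∣q∣ (inside ∷ p) (outside ∷ q) = cong suc (∣p∪q∣+∣p∩q∣≡∣p∣+∣q∣ p q)
∣p∪q∣+∣p∩q∣≡∣p∣+∣q∣ (inside ∷ p) (inside ∷ q) = cong suc (begin
  ∣ p ∪ q ∣ + suc ∣ p ∩ q ∣ ≡⟨ +-suc ∣ p ∪ q ∣ ∣ p ∩ q ∣ ⟩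
  suc (∣ p ∪ q ∣ + ∣ p ∩ q ∣) ≡⟨ cong suc (∣p∪q∣+∣p∩q∣≡∣p∣+∣q∣ p q) ⟩
  suc (∣ p ∣ + ∣ q ∣) ≡⟨ +-suc ∣ p ∣ ∣ q ∣ ⟨
  ∣ p ∣ + suc ∣ q ∣ ∎)
  where open ≡-Reasoning

∣p∣≤∣q∣+∣p─q∣ : ∀ {n} (p q : Subset n) → ∣ p ∣ ≤ ∣ q ∣ + ∣ p ─ q ∣
∣p∣≤∣q∣+∣p─q∣ [] [] = z≤n
∣p∣≤∣q∣+∣p─q∣ (outside ∷ p) (outside ∷ q) = ∣p∣≤∣q∣+∣p─q∣ p q
∣p∣≤∣q∣+∣p─q∣ (outside ∷ p) (inside ∷ q) = m≤n⇒m≤1+n (∣p∣≤∣q∣+∣p─q∣ p q)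
∣p∣≤∣q∣+∣p─q∣ (inside ∷ p) (outside ∷ q) =
  subst (suc ∣ p ∣ ≤_) (sym (+-suc ∣ q ∣ ∣ p ─ q ∣)) (s≤s (∣p∣≤∣q∣+∣p─q∣ p q))
∣p∣≤∣q∣+∣p─q∣ (inside ∷ p) (inside ∷ q) = s≤s (∣p∣≤∣q∣+∣p─q∣ p q)

x∈p⇒suc∣p-x∣≡∣p∣ : ∀ {n} {x : Fin n} {p : Subset n} → x ∈ p → suc ∣ p - x ∣ ≡ ∣ p ∣
x∈p⇒suc∣p-x∣≡∣p∣ {x = x} {p} x∈p = ≤-antisym (x∈p⇒∣p-x∣<∣p∣ x∈p)
  (subst (λ s → ∣ p ∣ ≤ s + ∣ p - x ∣) (∣⁅x⁆∣≡1 x) (∣p∣≤∣q∣+∣p─q∣ p ⁅ x ⁆))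

p⊆q∧∣q∣≤∣p∣⇒q⊆p : ∀ {n} {p q : Subset n} → p ⊆ q → ∣ q ∣ ≤ ∣ p ∣ → q ⊆ p
p⊆q∧∣q∣≤∣p∣⇒q⊆p {p = []} {[]} _ _ ()
p⊆q∧∣q∣≤∣p∣⇒q⊆p {p = outside ∷ p} {outside ∷ q} p⊆q ∣q∣≤∣p∣ (there x∈q) =
  there (p⊆q∧∣q∣≤∣p∣⇒q⊆p (drop-∷-⊆ p⊆q) ∣q∣≤∣p∣ x∈q)
p⊆q∧∣q∣≤∣p∣⇒q⊆p {p = outside ∷ p} {inside ∷ q} p⊆q ∣q∣≤∣p∣ =
  ⊥-elim (<⇒≱ (s≤s (p⊆q⇒∣p∣≤∣q∣ (drop-∷-⊆ p⊆q))) ∣q∣≤∣p∣)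
p⊆q∧∣q∣≤∣p∣⇒q⊆p {p = inside ∷ p} {outside ∷ q} p⊆q with p⊆q here
... | ()
p⊆q∧∣q∣≤∣p∣⇒q⊆p {p = inside ∷ p} {inside ∷ q} p⊆q ∣q∣≤∣p∣ here = here
p⊆q∧∣q∣≤∣p∣⇒q⊆p {p = inside ∷ p} {inside ∷ q} p⊆q ∣q∣≤∣p∣ (there x∈q) =
  there (p⊆q∧∣q∣≤∣p∣⇒q⊆p (drop-∷-⊆ p⊆q) (≤-pred ∣q∣≤∣p∣) x∈q)

injectiveOn⇒∣p∣≤∣q∣ : ∀ {m n} {p : Subset m} {q : Subset n} (f : Fin m → Fin n) →
  (∀ {x} → x ∈ p → f x ∈ q) →
  (∀ {x y} → x ∈ p → y ∈ p → f x ≡ f y → x ≡ y) →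
  ∣ p ∣ ≤ ∣ q ∣
injectiveOn⇒∣p∣≤∣q∣ {p = []} f _ _ = z≤n
injectiveOn⇒∣p∣≤∣q∣ {p = outside ∷ p} f maps inj =
  injectiveOn⇒∣p∣≤∣q∣ (f ∘ suc) (maps ∘ there)
    (λ x∈p y∈p → suc-injective ∘ inj (there x∈p) (there y∈p))
injectiveOn⇒∣p∣≤∣q∣ {p = inside ∷ p} {q} f maps inj = ≤-trans
  (s≤s (injectiveOn⇒∣p∣≤∣q∣ {q = q - f zero} (f ∘ suc)
    (λ x∈p → x∈p∧x≢y⇒x∈p-y (maps (there x∈p)) (λ fx≡f0 → 0≢suc (inj here (there x∈p) (sym fx≡f0))))
    (λ x∈p y∈p → suc-injective ∘ inj (there x∈p) (there y∈p))))
  (x∈p⇒∣p-x∣<∣p∣ (maps here))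
  where
  0≢suc : ∀ {k} {x : Fin k} → Fin.zero {k} ≢ suc x
  0≢suc ()

x∈p─q⇒x∉q : ∀ {n} {x : Fin n} {p q : Subset n} → x ∈ p ─ q → x ∉ q
x∈p─q⇒x∉q {p = inside ∷ p} {outside ∷ q} here ()
x∈p─q⇒x∉q {p = _ ∷ p} {_ ∷ q} (there x∈p─q) (there x∈q) = x∈p─q⇒x∉q x∈p─q x∈q

[1+n]C2≡n+nC2 : ∀ n → suc n C 2 ≡ n + n C 2
[1+n]C2≡n+nC2 n = trans (sym (nCk+nC[k+1]≡[n+1]C[k+1] n 1)) (cong (_+ n C 2) (nC1≡n n))

[1+n]C2+nC2≡n*n : ∀ n → suc n C 2 + n C 2 ≡ n * n
[1+n]C2+nC2≡n*n zero = refl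
[1+n]C2+nC2≡n*n (suc n) = begin
  suc (suc n) C 2 + suc n C 2 ≡⟨ cong₂ _+_ ([1+n]C2≡n+nC2 (suc n)) ([1+n]C2≡n+nC2 n) ⟩
  (suc n + suc n C 2) + (n + n C 2) ≡⟨ regroup (suc n C 2) (n C 2) n ⟩
  suc n + n + (suc n C 2 + n C 2) ≡⟨ cong (suc n + n +_) ([1+n]C2+nC2≡n*n n) ⟩
  suc n + n + n * n ≡⟨ square n ⟩
  suc n * suc n ∎
  where
  open ≡-Reasoning
  regroup : ∀ x y n → (suc n + x) + (n + y) ≡ suc n + n + (x + y)
  regroup = solve-∀
  square : ∀ n → suc n + n + n * n ≡ suc n * suc n
  square = solve-∀

nC2+[2+n]C2≡1+[1+n]*n : ∀ n → n C 2 + suc (suc n) C 2 ≡ suc (suc n * n)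
nC2+[2+n]C2≡1+[1+n]*n n = begin
  n C 2 + suc (suc n) C 2 ≡⟨ cong (n C 2 +_) ([1+n]C2≡n+nC2 (suc n)) ⟩
  n C 2 + (suc n + suc n C 2) ≡⟨ regroup (n C 2) (suc n C 2) n ⟩
  suc n + (suc n C 2 + n C 2) ≡⟨ cong (suc n +_) ([1+n]C2+nC2≡n*n n) ⟩
  suc n + n * n ∎
  where
  open ≡-Reasoning
  regroup : ∀ x y n → x + (suc n + y) ≡ suc n + (y + x)
  regroup = solve-∀

n≤1⇒nC2≡0 : ∀ {n} → n ≤ 1 → n C 2 ≡ 0
n≤1⇒nC2≡0 z≤n = refl
n≤1⇒nC2≡0 (s≤s z≤n) = refl

module _ {n m : ℕ} (G : Graph n m) where

  ∈edgesIn⁻ : ∀ {X e} → e ∈ edgesIn G X → proj₁ (ends G e) ∈ X × proj₂ (ends G e) ∈ X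
  ∈edgesIn⁻ {X} {e} e∈ =
    lookup⇒[]= _ X (∧-conicalˡ _ _ ends∈) , lookup⇒[]= _ X (∧-conicalʳ _ _ ends∈)
    where ends∈ = trans (sym (lookup∘tabulate _ e)) ([]=⇒lookup e∈)

  ∈edgesIn⁺ : ∀ {X e} → proj₁ (ends G e) ∈ X → proj₂ (ends G e) ∈ X → e ∈ edgesIn G X
  ∈edgesIn⁺ {X} {e} a∈X b∈X = lookup⇒[]= e _
    (trans (lookup∘tabulate _ e) (cong₂ _∧_ ([]=⇒lookup a∈X) ([]=⇒lookup b∈X)))

  edgesIn-mono : ∀ {X Y} → X ⊆ Y → edgesIn G X ⊆ edgesIn G Y
  edgesIn-mono X⊆Y e∈ with ∈edgesIn⁻ e∈
  ... | a∈X , b∈X = ∈edgesIn⁺ (X⊆Y a∈X) (X⊆Y b∈X)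

  edgesIn-∪ : ∀ X Y → edgesIn G X ∪ edgesIn G Y ⊆ edgesIn G (X ∪ Y)
  edgesIn-∪ X Y e∈ with x∈p∪q⁻ (edgesIn G X) (edgesIn G Y) e∈
  ... | inj₁ e∈X = edgesIn-mono {X} (p⊆p∪q Y) e∈X
  ... | inj₂ e∈Y = edgesIn-mono {Y} (q⊆p∪q X Y) e∈Y

  edgesIn-∩ : ∀ X Y → edgesIn G X ∩ edgesIn G Y ⊆ edgesIn G (X ∩ Y)
  edgesIn-∩ X Y e∈ with x∈p∩q⁻ (edgesIn G X) (edgesIn G Y) e∈
  ... | e∈X , e∈Y with ∈edgesIn⁻ e∈X | ∈edgesIn⁻ e∈Y
  ... | a∈X , b∈X | a∈Y , b∈Y = ∈edgesIn⁺ {X ∩ Y} (x∈p∩q⁺ (a∈X , a∈Y)) (x∈p∩q⁺ (b∈X , b∈Y))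

  i-supermodular : ∀ X Y → i G X + i G Y ≤ i G (X ∪ Y) + i G (X ∩ Y)
  i-supermodular X Y = begin
    i G X + i G Y
      ≡⟨ ∣p∪q∣+∣p∩q∣≡∣p∣+∣q∣ (edgesIn G X) (edgesIn G Y) ⟨
    ∣ edgesIn G X ∪ edgesIn G Y ∣ + ∣ edgesIn G X ∩ edgesIn G Y ∣
      ≤⟨ +-mono-≤ (p⊆q⇒∣p∣≤∣q∣ (edgesIn-∪ X Y)) (p⊆q⇒∣p∣≤∣q∣ (edgesIn-∩ X Y)) ⟩
    i G (X ∪ Y) + i G (X ∩ Y) ∎
    where open ≤-Reasoning

  sameEnds⇒≡ : ∀ {e f} {p : Fin n × Fin n} →
    (ends G e ≡ p ⊎ ends G e ≡ swap p) → (ends G f ≡ p ⊎ ends G f ≡ swap p) → e ≡ f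
  sameEnds⇒≡ {e} {f} (inj₁ e≡p) (inj₁ f≡p) = simple G e f (inj₁ (trans e≡p (sym f≡p)))
  sameEnds⇒≡ {e} {f} (inj₁ e≡p) (inj₂ f≡p) = simple G e f (inj₂ (trans e≡p (cong swap (sym f≡p))))
  sameEnds⇒≡ {e} {f} (inj₂ e≡p) (inj₁ f≡p) = simple G e f (inj₂ (trans e≡p (cong swap (sym f≡p))))
  sameEnds⇒≡ {e} {f} (inj₂ e≡p) (inj₂ f≡p) = simple G e f (inj₁ (trans e≡p (sym f≡p)))

  module _ (v : Fin n) where

    opposite : Fin m → Fin n
    opposite e with proj₁ (ends G e) ≟ v
    ... | yes _ = proj₂ (ends G e)
    ... | no _ = proj₁ (ends G e)

    opposite≢ : ∀ e → opposite e ≢ v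
    opposite≢ e with proj₁ (ends G e) ≟ v
    ... | yes a≡v = λ b≡v → loopless G e (trans a≡v (sym b≡v))
    ... | no a≢v = a≢v

    opposite∈ : ∀ {X e} → e ∈ edgesIn G X → opposite e ∈ X
    opposite∈ {e = e} e∈ with proj₁ (ends G e) ≟ v
    ... | yes _ = proj₂ (∈edgesIn⁻ e∈)
    ... | no _ = proj₁ (∈edgesIn⁻ e∈)

    ends-via-opposite : ∀ e → proj₁ (ends G e) ≡ v ⊎ proj₂ (ends G e) ≡ v →
      ends G e ≡ (v , opposite e) ⊎ ends G e ≡ swap (v , opposite e)
    ends-via-opposite e incident with proj₁ (ends G e) ≟ v | incident
    ... | yes a≡v | _ = inj₁ (cong (_, proj₂ (ends G e)) a≡v)
    ... | no a≢v | inj₁ a≡v = ⊥-elim (a≢v a≡v)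
    ... | no _ | inj₂ b≡v = inj₂ (cong (proj₁ (ends G e) ,_) b≡v)

    module _ (X : Subset n) where

      ∈─edgesIn[X-v]⇒incident : ∀ {e} → e ∈ edgesIn G X ─ edgesIn G (X - v) →
        proj₁ (ends G e) ≡ v ⊎ proj₂ (ends G e) ≡ v
      ∈─edgesIn[X-v]⇒incident {e} e∈
        with proj₁ (ends G e) ≟ v | proj₂ (ends G e) ≟ v | ∈edgesIn⁻ {X} (p─q⊆p _ _ e∈)
      ... | yes a≡v | _ | _ = inj₁ a≡v
      ... | no _ | yes b≡v | _ = inj₂ b≡v
      ... | no a≢v | no b≢v | a∈X , b∈X = ⊥-elim (x∈p─q⇒x∉q e∈
            (∈edgesIn⁺ (x∈p∧x≢y⇒x∈p-y a∈X a≢v) (x∈p∧x≢y⇒x∈p-y b∈X b≢v)))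

      -- An edge lost by deleting v is determined by its other end, which lies in X - v.
      ∣edgesIn[X]─edgesIn[X-v]∣≤∣X-v∣ : ∣ edgesIn G X ─ edgesIn G (X - v) ∣ ≤ ∣ X - v ∣
      ∣edgesIn[X]─edgesIn[X-v]∣≤∣X-v∣ = injectiveOn⇒∣p∣≤∣q∣ opposite
        (λ e∈ → x∈p∧x≢y⇒x∈p-y (opposite∈ {X} (p─q⊆p _ _ e∈)) (opposite≢ _))
        (λ {e} {f} e∈ f∈ eq → sameEnds⇒≡
          (ends-via-opposite e (∈─edgesIn[X-v]⇒incident e∈))
          (subst (λ w → ends G f ≡ (v , w) ⊎ ends G f ≡ swap (v , w)) (sym eq)
            (ends-via-opposite f (∈─edgesIn[X-v]⇒incident f∈))))

      i≤i[X-v]+∣X-v∣ : i G X ≤ i G (X - v) + ∣ X - v ∣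
      i≤i[X-v]+∣X-v∣ = ≤-trans
        (∣p∣≤∣q∣+∣p─q∣ (edgesIn G X) (edgesIn G (X - v)))
        (+-monoʳ-≤ (i G (X - v)) ∣edgesIn[X]─edgesIn[X-v]∣≤∣X-v∣)

  Empty⇒i≡0 : ∀ {X} → Empty X → i G X ≡ 0
  Empty⇒i≡0 X-empty = trans
    (cong ∣_∣ (Empty-unique λ (_ , e∈) → X-empty (_ , proj₁ (∈edgesIn⁻ e∈))))
    (∣⊥∣≡0 m)

  i≤∣X∣C2 : ∀ X → i G X ≤ ∣ X ∣ C 2
  i≤∣X∣C2 X = bound _ X refl
    where
    bound : ∀ k X → ∣ X ∣ ≡ k → i G X ≤ k C 2
    bound k X _ with nonempty? X
    ... | no X-empty = subst (_≤ k C 2) (sym (Empty⇒i≡0 X-empty)) z≤n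
    bound zero X ∣X∣≡0 | yes (v , v∈X) =
      ⊥-elim (0≢1+n (trans (sym ∣X∣≡0) (sym (x∈p⇒suc∣p-x∣≡∣p∣ v∈X))))
    bound (suc k) X ∣X∣≡1+k | yes (v , v∈X) = begin
      i G X                   ≤⟨ i≤i[X-v]+∣X-v∣ v X ⟩
      i G (X - v) + ∣ X - v ∣ ≤⟨ +-mono-≤ (bound k (X - v) ∣X-v∣≡k) (≤-reflexive ∣X-v∣≡k) ⟩
      k C 2 + k               ≡⟨ +-comm (k C 2) k ⟩
      k + k C 2               ≡⟨ [1+n]C2≡n+nC2 k ⟨
      suc k C 2               ∎
      where
      open ≤-Reasoning
      ∣X-v∣≡k : ∣ X - v ∣ ≡ k
      ∣X-v∣≡k = ℕ.suc-injective (trans (x∈p⇒suc∣p-x∣≡∣p∣ v∈X) ∣X∣≡1+k)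

module _ {n m : ℕ} (G : Graph n m) (d : ℕ) where

  Tight : Subset n → Set
  Tight X = i G X + suc d C 2 ≡ d * ∣ X ∣

  -- The sets U for which (U, edgesIn G U) is d-critical.
  CriticalSet : Subset n → Set
  CriticalSet X = (∣ X ∣ ≡ 2 × i G X ≡ 1) ⊎ (d + 2 ≤ ∣ X ∣ × Tight X)

  tight-∪-∩ : ∀ X Y → Tight X → Tight Y →
    d * ∣ X ∪ Y ∣ + d * ∣ X ∩ Y ∣ ≤ (i G (X ∪ Y) + suc d C 2) + (i G (X ∩ Y) + suc d C 2)
  tight-∪-∩ X Y tight-X tight-Y = begin
    d * ∣ X ∪ Y ∣ + d * ∣ X ∩ Y ∣   ≡⟨ *-distribˡ-+ d ∣ X ∪ Y ∣ ∣ X ∩ Y ∣ ⟨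
    d * (∣ X ∪ Y ∣ + ∣ X ∩ Y ∣)     ≡⟨ cong (d *_) (∣p∪q∣+∣p∩q∣≡∣p∣+∣q∣ X Y) ⟩
    d * (∣ X ∣ + ∣ Y ∣)             ≡⟨ *-distribˡ-+ d ∣ X ∣ ∣ Y ∣ ⟩
    d * ∣ X ∣ + d * ∣ Y ∣           ≡⟨ cong₂ _+_ tight-X tight-Y ⟨
    (i G X + c) + (i G Y + c)       ≡⟨ +-interchange (i G X) c (i G Y) c ⟩
    (i G X + i G Y) + (c + c)       ≤⟨ +-monoˡ-≤ (c + c) (i-supermodular G X Y) ⟩
    (i G (X ∪ Y) + i G (X ∩ Y)) + (c + c) ≡⟨ +-interchange (i G (X ∪ Y)) (i G (X ∩ Y)) c c ⟩
    (i G (X ∪ Y) + c) + (i G (X ∩ Y) + c) ∎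
    where
    open ≤-Reasoning
    c = suc d C 2

  criticalSet⇒critical : ∀ X → CriticalSet X → Critical G d X (edgesIn G X)
  criticalSet⇒critical X (inj₁ edge) = id , inj₁ edge
  criticalSet⇒critical X (inj₂ (large , tight)) =
    id , inj₂ (large , trans (sym (m+n∸n≡m (i G X) (suc d C 2))) (cong (_∸ suc d C 2) tight))

  critical⇒criticalSet : Sparse G d → ∀ {X F} → Critical G d X F → CriticalSet X
  critical⇒criticalSet _ {X} {F} (F⊆ , inj₁ (∣X∣≡2 , ∣F∣≡1)) =
    inj₁ (∣X∣≡2 , ≤-antisym (subst (i G X ≤_) (cong (_C 2) ∣X∣≡2) (i≤∣X∣C2 G X))
                            (subst (_≤ i G X) ∣F∣≡1 (p⊆q⇒∣p∣≤∣q∣ F⊆)))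
  critical⇒criticalSet sparse {X} {F} (F⊆ , inj₂ (large , ∣F∣≡)) =
    inj₂ (large , trans (cong (_+ suc d C 2) i≡) (m∸n+n≡m (m+n≤o⇒n≤o (i G X) sparse-X)))
    where
    sparse-X : i G X + suc d C 2 ≤ d * ∣ X ∣
    sparse-X = sparse X (≤-trans (m≤m+n d 2) large)
    i≡ : i G X ≡ d * ∣ X ∣ ∸ suc d C 2
    i≡ = ≤-antisym (m+n≤o⇒m≤o∸n (i G X) sparse-X) (subst (_≤ i G X) ∣F∣≡ (p⊆q⇒∣p∣≤∣q∣ F⊆))

  criticalSet⇒2≤∣X∣ : ∀ X → CriticalSet X → 2 ≤ ∣ X ∣
  criticalSet⇒2≤∣X∣ _ (inj₁ (∣X∣≡2 , _)) = ≤-reflexive (sym ∣X∣≡2)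
  criticalSet⇒2≤∣X∣ _ (inj₂ (large , _)) = ≤-trans (m≤n+m 2 d) large

  criticalSet⇒⊆⊎large : ∀ X Y → CriticalSet X → 2 ≤ ∣ X ∩ Y ∣ →
    X ⊆ Y ⊎ (d + 2 ≤ ∣ X ∣ × Tight X)
  criticalSet⇒⊆⊎large X Y (inj₁ (∣X∣≡2 , _)) 2≤∣X∩Y∣ = inj₁ (p∩q⊆q X Y ∘ X⊆X∩Y)
    where
    X⊆X∩Y : X ⊆ X ∩ Y
    X⊆X∩Y = p⊆q∧∣q∣≤∣p∣⇒q⊆p (p∩q⊆p X Y) (subst (_≤ ∣ X ∩ Y ∣) (sym ∣X∣≡2) 2≤∣X∩Y∣)
  criticalSet⇒⊆⊎large _ _ (inj₂ large) _ = inj₂ large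

  component-maximal : ∀ {X F} Y → CriticalComponent G d X F → CriticalSet Y → X ⊆ Y →
    (X , F) ≡ (Y , edgesIn G Y)
  component-maximal {X} Y (critical , maximal) critical-Y X⊆Y =
    maximal Y (edgesIn G Y) (criticalSet⇒critical Y critical-Y) X⊆Y
      (edgesIn-mono G {X} X⊆Y ∘ proj₁ critical)

criticalSet⇒tight₁ : ∀ {n m} (G : Graph n m) X → CriticalSet G 1 X → Tight G 1 X
criticalSet⇒tight₁ _ _ (inj₁ (∣X∣≡2 , i≡1)) rewrite ∣X∣≡2 | i≡1 = refl
criticalSet⇒tight₁ _ _ (inj₂ (_ , tight)) = tight

m+n≤o+p∧p≤n⇒m≤o : ∀ {m n o p} → m + n ≤ o + p → p ≤ n → m ≤ o
m+n≤o+p∧p≤n⇒m≤o {m} {n} {o} m+n≤o+p p≤n =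
  +-cancelʳ-≤ n m o (≤-trans m+n≤o+p (+-monoʳ-≤ o p≤n))

m+n≤o+p∧o<m⇒n<p : ∀ {m n o p} → m + n ≤ o + p → o < m → n < p
m+n≤o+p∧o<m⇒n<p m+n≤o+p o<m = ≰⇒> (<⇒≱ o<m ∘ m+n≤o+p∧p≤n⇒m≤o m+n≤o+p)

[1+k]*k<x+[2+k]C2⇒kC2≤x : ∀ k x → suc k * k < x + suc (suc k) C 2 → k C 2 ≤ x
[1+k]*k<x+[2+k]C2⇒kC2≤x k x lt = +-cancelʳ-≤ (suc (suc k) C 2) (k C 2) x
  (subst (_≤ x + suc (suc k) C 2) (sym (nC2+[2+n]C2≡1+[1+n]*n k)) lt)

module DistinctComponents {n m : ℕ} (G : Graph n m) (d : ℕ) (sparse : Sparse G d)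
  {U₁ U₂ : Subset n} {F₁ F₂ : Subset m}
  (component₁ : CriticalComponent G d U₁ F₁) (component₂ : CriticalComponent G d U₂ F₂)
  (distinct : (U₁ , F₁) ≢ (U₂ , F₂)) where

  critical₁ : CriticalSet G d U₁
  critical₁ = critical⇒criticalSet G d sparse {U₁} (proj₁ component₁)

  critical₂ : CriticalSet G d U₂
  critical₂ = critical⇒criticalSet G d sparse {U₂} (proj₁ component₂)

  no-critical-superset : ∀ {W} → CriticalSet G d W → U₁ ⊆ W → U₂ ⊆ W → ⊥
  no-critical-superset {W} critical-W U₁⊆W U₂⊆W = distinct (trans
    (component-maximal G d W component₁ critical-W U₁⊆W)
    (sym (component-maximal G d W component₂ critical-W U₂⊆W)))

  union-not-tight : d + 2 ≤ ∣ U₁ ∪ U₂ ∣ → ¬ Tight G d (U₁ ∪ U₂)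
  union-not-tight large tight = no-critical-superset {U₁ ∪ U₂} (inj₂ (large , tight))
    (p⊆p∪q U₂) (q⊆p∪q U₁ U₂)

  both-large : 2 ≤ ∣ U₁ ∩ U₂ ∣ →
    (d + 2 ≤ ∣ U₁ ∣ × Tight G d U₁) × (d + 2 ≤ ∣ U₂ ∣ × Tight G d U₂)
  both-large 2≤∣U₁∩U₂∣ with
    criticalSet⇒⊆⊎large G d U₁ U₂ critical₁ 2≤∣U₁∩U₂∣ |
    criticalSet⇒⊆⊎large G d U₂ U₁ critical₂ (subst (λ X → 2 ≤ ∣ X ∣) (∩-comm U₁ U₂) 2≤∣U₁∩U₂∣)
  ... | inj₁ U₁⊆U₂ | _ = ⊥-elim (no-critical-superset {U₂} critical₂ U₁⊆U₂ id)
  ... | inj₂ _ | inj₁ U₂⊆U₁ = ⊥-elim (no-critical-superset {U₁} critical₁ id U₂⊆U₁)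
  ... | inj₂ large₁ | inj₂ large₂ = large₁ , large₂

  tight-and-large : 1 ≤ d → d ≤ ∣ U₁ ∩ U₂ ∣ →
    Tight G d U₁ × Tight G d U₂ × d + 2 ≤ ∣ U₁ ∪ U₂ ∣
  tight-and-large 1≤d d≤k with 2 ≤? ∣ U₁ ∩ U₂ ∣
  ... | yes 2≤k with both-large 2≤k
  ...   | (large₁ , tight₁) , (_ , tight₂) = tight₁ , tight₂ , ≤-trans large₁ (∣p∣≤∣p∪q∣ U₁ U₂)
  -- Here d ≤ |U₁ ∩ U₂| ≤ 1 forces d = 1, where a single edge is tight as well.
  tight-and-large 1≤d d≤k | no k≱2 =
    tight₁ U₁ critical₁ , tight₁ U₂ critical₂ ,
    subst (λ d → d + 2 ≤ ∣ U₁ ∪ U₂ ∣) (sym d≡1) 3≤∣U₁∪U₂∣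
    where
    k≤1 : ∣ U₁ ∩ U₂ ∣ ≤ 1
    k≤1 = ≤-pred (≰⇒> k≱2)
    d≡1 : d ≡ 1
    d≡1 = ≤-antisym (≤-trans d≤k k≤1) 1≤d
    tight₁ : ∀ X → CriticalSet G d X → Tight G d X
    tight₁ X = subst (λ d → CriticalSet G d X → Tight G d X) (sym d≡1) (criticalSet⇒tight₁ G X)
    3≤∣U₁∪U₂∣ : 3 ≤ ∣ U₁ ∪ U₂ ∣
    3≤∣U₁∪U₂∣ = +-cancelʳ-≤ 1 3 ∣ U₁ ∪ U₂ ∣ (begin
      4                             ≤⟨ +-mono-≤ (criticalSet⇒2≤∣X∣ G d U₁ critical₁)
                                                (criticalSet⇒2≤∣X∣ G d U₂ critical₂) ⟩
      ∣ U₁ ∣ + ∣ U₂ ∣               ≡⟨ ∣p∪q∣+∣p∩q∣≡∣p∣+∣q∣ U₁ U₂ ⟨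
      ∣ U₁ ∪ U₂ ∣ + ∣ U₁ ∩ U₂ ∣     ≤⟨ +-monoʳ-≤ ∣ U₁ ∪ U₂ ∣ k≤1 ⟩
      ∣ U₁ ∪ U₂ ∣ + 1               ∎)
      where open ≤-Reasoning

  ∣U₁∩U₂∣<d : 1 ≤ d → ∣ U₁ ∩ U₂ ∣ < d
  ∣U₁∩U₂∣<d 1≤d = ≰⇒> λ d≤k →
    let tight₁ , tight₂ , large = tight-and-large 1≤d d≤k in
    union-not-tight large (≤-antisym
      (sparse (U₁ ∪ U₂) (≤-trans (m≤m+n d 2) large))
      (m+n≤o+p∧p≤n⇒m≤o (tight-∪-∩ G d U₁ U₂ tight₁ tight₂) (sparse (U₁ ∩ U₂) d≤k)))

  ∣U₁∩U₂∣C2≤i : suc ∣ U₁ ∩ U₂ ∣ ≡ d → ∣ U₁ ∩ U₂ ∣ C 2 ≤ i G (U₁ ∩ U₂)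
  ∣U₁∩U₂∣C2≤i 1+k≡d with 2 ≤? ∣ U₁ ∩ U₂ ∣
  ... | no k≱2 = subst (_≤ i G (U₁ ∩ U₂)) (sym (n≤1⇒nC2≡0 (≤-pred (≰⇒> k≱2)))) z≤n
  ... | yes 2≤k with both-large 2≤k
  ...   | (large₁ , tight₁) , (_ , tight₂) = [1+k]*k<x+[2+k]C2⇒kC2≤x ∣ U₁ ∩ U₂ ∣ (i G (U₁ ∩ U₂))
    (subst (λ d → d * ∣ U₁ ∩ U₂ ∣ < i G (U₁ ∩ U₂) + suc d C 2) (sym 1+k≡d)
      (m+n≤o+p∧o<m⇒n<p (tight-∪-∩ G d U₁ U₂ tight₁ tight₂) union-slack))
    where
    union-large : d + 2 ≤ ∣ U₁ ∪ U₂ ∣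
    union-large = ≤-trans large₁ (∣p∣≤∣p∪q∣ U₁ U₂)
    union-slack : i G (U₁ ∪ U₂) + suc d C 2 < d * ∣ U₁ ∪ U₂ ∣
    union-slack = ≤∧≢⇒< (sparse (U₁ ∪ U₂) (≤-trans (m≤m+n d 2) union-large))
      (union-not-tight union-large)

lemma2p1 : ∀ {n m : ℕ} (G : Graph n m) (d : ℕ) → d ≥ 1 → Sparse G d →
    (U₁ U₂ : Subset n) (F₁ F₂ : Subset m) →
    CriticalComponent G d U₁ F₁ → CriticalComponent G d U₂ F₂ →
    (U₁ , F₁) ≢ (U₂ , F₂) →
    (∣ U₁ ∩ U₂ ∣ ≤ d ∸ 1) ×
    (∣ U₁ ∩ U₂ ∣ ≡ d ∸ 1 → i G (U₁ ∩ U₂) ≡ (d ∸ 1) C 2)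
lemma2p1 G d@(suc _) 1≤d sparse U₁ U₂ F₁ F₂ component₁ component₂ distinct =
  <⇒≤pred (∣U₁∩U₂∣<d 1≤d) ,
  λ k≡e → subst (λ k → i G (U₁ ∩ U₂) ≡ k C 2) k≡e
    (≤-antisym (i≤∣X∣C2 G (U₁ ∩ U₂)) (∣U₁∩U₂∣C2≤i (cong suc k≡e)))
  where open DistinctComponents G d sparse component₁ component₂ distinct
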